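{- Let $K$ be a number field and $\ell$ a prime number, and suppose that $\ell$ is odd or that $\zeta_4\in K$. Let $a_1,\ldots,a_r\in K^\times$ be strongly $\ell$-independent and let $x_1,\ldots,x_r$ and $n\geqslant 0$ be integers. If $a_1^{x_1}\cdots a_r^{x_r}\in(K^\times)^{\ell^n}$, then $x_1,\ldots,x_r$ are all divisible by $\ell^n$.
   Context: An element $a\in K^\times$ is strongly $\ell$-indivisible if there is no root of unity $\zeta\in K$ of $\ell$-power order with $a\zeta\in(K^\times)^\ell$. Elements $a_1,\ldots,a_r\in K^\times$ are strongly $\ell$-independent if $a_1^{x_1}\cdots a_r^{x_r}$ is strongly $\ell$-indivisible whenever $x_1,\ldots,x_r$ are integers not all divisible by $\ell$. $(K^\times)^k=\{x^k:x\in K^\times\}$. -}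

module Defs where

open import Level using (Level; _⊔_)
open import Algebra.Bundles using (CommutativeRing)
open import Data.Nat as ℕ using (ℕ; zero; suc)
open import Data.Integer as ℤ using (ℤ; +_; -[1+_])
open import Data.Integer.Divisibility as ℤ∣ using ()
open import Data.Rational as ℚ using (ℚ)
open import Data.Fin using (Fin; zero; suc)
open import Data.Product using (Σ; ∃; _×_; _,_)
open import Data.Sum using (_⊎_)
open import Relation.Nullary using (¬_)

lincomb : ∀ {c ℓ} (R : CommutativeRing c ℓ) → let open CommutativeRing R using (Carrier) in
  (ℚ → Carrier) → (n : ℕ) → (Fin n → Carrier) → (Fin n → ℚ) → Carrier
lincomb R ι zero    b q = CommutativeRing.0# R
lincomb R ι (suc n) b q = let open CommutativeRing R using (_+_; _*_) in
  ι (q zero) * b zero + lincomb R ι n (λ i → b (suc i)) (λ i → q (suc i))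

-- A number field: a field K of characteristic zero (given by a ring
-- homomorphism ι : ℚ → K) which is finite-dimensional as a ℚ-vector space
-- (spanned by finitely many elements b₀,…,b_{d-1}).
record NumberField (c ℓ : Level) : Set (Level.suc (c ⊔ ℓ)) where
  field
    ring : CommutativeRing c ℓ
  open CommutativeRing ring public
    using (Carrier; _≈_; _+_; _*_; -_; 0#; 1#)
  field
    0≉1      : ¬ (0# ≈ 1#)
    inverses : ∀ x → ¬ (x ≈ 0#) → ∃ λ y → x * y ≈ 1#
    ι        : ℚ → Carrier
    ι-+      : ∀ p q → ι (p ℚ.+ q) ≈ ι p + ι q
    ι-*      : ∀ p q → ι (p ℚ.* q) ≈ ι p * ι q
    ι-1      : ι ℚ.1ℚ ≈ 1#
    dim      : ℕ
    basis    : Fin dim → Carrier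
    spans    : ∀ x → ∃ λ (q : Fin dim → ℚ) → x ≈ lincomb ring ι dim basis q

module _ {c ℓ : Level} (K : NumberField c ℓ) where
  open NumberField K

  _^_ : Carrier → ℕ → Carrier
  x ^ zero  = 1#
  x ^ suc n = x * (x ^ n)

  -- elements of K^× : nonzero elements together with their inverse
  record Unit : Set (c ⊔ ℓ) where
    constructor unit
    field
      val     : Carrier
      inv     : Carrier
      inverse : val * inv ≈ 1#

  open Unit public

  zpow : Unit → ℤ → Carrier
  zpow u (+ n)     = val u ^ n
  zpow u -[1+ n ]  = inv u ^ suc n

  prodPow : (r : ℕ) → (Fin r → Unit) → (Fin r → ℤ) → Carrier
  prodPow zero    a x = 1#
  prodPow (suc r) a x = zpow (a zero) (x zero) * prodPow r (λ i → a (suc i)) (λ i → x (suc i))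

  InPowers : ℕ → Carrier → Set (c ⊔ ℓ)
  InPowers k y = ∃ λ (z : Unit) → val z ^ k ≈ y

  -- ζ is a root of unity of ℓ-power order (its order divides some ℓ^m,
  -- i.e. equals some ℓ^j)
  RootOfUnityℓPower : ℕ → Carrier → Set ℓ
  RootOfUnityℓPower p ζ = ∃ λ (m : ℕ) → ζ ^ (p ℕ.^ m) ≈ 1#

  StronglyIndivisible : ℕ → Carrier → Set (c ⊔ ℓ)
  StronglyIndivisible p a =
    ¬ (∃ λ (ζ : Carrier) → RootOfUnityℓPower p ζ × InPowers p (a * ζ))

  StronglyIndependent : ℕ → (r : ℕ) → (Fin r → Unit) → Set (c ⊔ ℓ)
  StronglyIndependent p r a =
    ∀ (x : Fin r → ℤ) → ¬ (∀ i → (+ p) ℤ∣.∣ x i) →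
      StronglyIndivisible p (prodPow r a x)

  HasZeta4 : Set (c ⊔ ℓ)
  HasZeta4 = ∃ λ (z : Carrier) → (z ^ 4 ≈ 1#) × ¬ (z ^ 2 ≈ 1#)

{-# OPTIONS --safe #-}
module Submission where

-- Strengthen the claim to: if a₁^{x₁}⋯a_r^{x_r}·ζ is an ℓⁿ-th power for some root of unity ζ
-- of ℓ-power order, then ℓⁿ divides every xᵢ; prove this by induction on n.  If some xᵢ is
-- not divisible by ℓ, strong independence is contradicted at once.  Otherwise
-- a₁^{x₁}⋯a_r^{x_r} = w^ℓ with w = a₁^{x₁/ℓ}⋯a_r^{x_r/ℓ}, and if the twisted product equals
-- z^{ℓⁿ⁺¹} = t^ℓ with t = z^{ℓⁿ}, then η = t/w satisfies η^ℓ = ζ, so it is again a root of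
-- unity of ℓ-power order and w·η = z^{ℓⁿ}: the induction hypothesis applies to the xᵢ/ℓ.

open import Defs hiding (_^_)
open import Level using (Level)
open import Data.Nat as ℕ using (ℕ; zero; suc; NonZero)
open import Data.Nat.Primality using (Prime; prime⇒nonZero)
open import Data.Nat.Divisibility as ℕ∣ using ()
open import Data.Integer as ℤ using (ℤ; +_; -[1+_]; ∣_∣)
open import Data.Integer.Divisibility as ℤ∣ using ()
open import Data.Fin using (Fin)
open import Data.Fin.Properties using (all?)
open import Data.Sum using (_⊎_)
open import Data.Product using (∃; ∃₂; _×_; _,_; proj₁; proj₂)
open import Data.Empty using (⊥-elim)
open import Relation.Nullary using (¬_; Dec; yes; no)
open import Relation.Binary.PropositionalEquality as P using (_≡_)
import Data.Nat.Properties as ℕ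
open import Algebra.Bundles using (CommutativeRing)
import Algebra.Properties.CommutativeSemiring.Exp as SemiringExp

module _ {c l : Level} (K : NumberField c l) where
  open NumberField K using (ring)
  open CommutativeRing ring
  open import Relation.Binary.Reasoning.Setoid setoid
  private module Exp = SemiringExp commutativeSemiring

  infixr 8 _^_
  _^_ : Carrier → ℕ → Carrier
  _^_ = Defs._^_ K

  ^≡Exp^ : ∀ x n → x ^ n ≡ x Exp.^ n
  ^≡Exp^ x zero    = P.refl
  ^≡Exp^ x (suc n) = P.cong (x *_) (^≡Exp^ x n)

  ^-congˡ : ∀ n {x y} → x ≈ y → x ^ n ≈ y ^ n
  ^-congˡ n {x} {y} rewrite ^≡Exp^ x n | ^≡Exp^ y n = Exp.^-congˡ n

  ^-assocʳ : ∀ x m n → (x ^ m) ^ n ≈ x ^ (m ℕ.* n)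
  ^-assocʳ x m n rewrite ^≡Exp^ (x ^ m) n | ^≡Exp^ x m | ^≡Exp^ x (m ℕ.* n) =
    Exp.^-assocʳ x m n

  ^-distrib-* : ∀ x y n → (x * y) ^ n ≈ x ^ n * y ^ n
  ^-distrib-* x y n rewrite ^≡Exp^ (x * y) n | ^≡Exp^ x n | ^≡Exp^ y n = Exp.^-distrib-* x y n

  1^n≈1 : ∀ n → 1# ^ n ≈ 1#
  1^n≈1 zero    = refl
  1^n≈1 (suc n) = trans (*-identityˡ _) (1^n≈1 n)

  ^-* : ∀ x m n → x ^ (m ℕ.* n) ≈ (x ^ n) ^ m
  ^-* x m n = trans (reflexive (P.cong (x ^_) (ℕ.*-comm m n))) (sym (^-assocʳ x n m))

  powUnit : Unit K → ℕ → Unit K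
  powUnit u n = unit (val u ^ n) (inv u ^ n) (begin
    val u ^ n * inv u ^ n  ≈⟨ ^-distrib-* (val u) (inv u) n ⟨
    (val u * inv u) ^ n    ≈⟨ ^-congˡ n (inverse u) ⟩
    1# ^ n                 ≈⟨ 1^n≈1 n ⟩
    1#                     ∎)

  zpow-root : ∀ {p} (u : Unit K) x → + p ℤ∣.∣ x →
    ∃ λ y → ∣ x ∣ ≡ p ℕ.* ∣ y ∣ × zpow K u x ≈ zpow K u y ^ p
  zpow-root {p} u (+ n) (ℤ∣.divides k n≡k*p) =
    + k , P.trans n≡k*p (ℕ.*-comm k p) , trans (reflexive (P.cong (val u ^_) n≡k*p)) (sym (^-assocʳ (val u) k p))
  zpow-root {p} u -[1+ n ] (ℤ∣.divides (suc k) 1+n≡k*p) =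
    -[1+ k ] , P.trans 1+n≡k*p (ℕ.*-comm (suc k) p) ,
    trans (reflexive (P.cong (inv u ^_) 1+n≡k*p)) (sym (^-assocʳ (inv u) (suc k) p))

  prodPow-^ : ∀ p r (a : Fin r → Unit K) x y →
    (∀ i → zpow K (a i) (x i) ≈ zpow K (a i) (y i) ^ p) →
    prodPow K r a x ≈ prodPow K r a y ^ p
  prodPow-^ p zero    a x y _ = sym (1^n≈1 p)
  prodPow-^ p (suc r) a x y x≈y^p =
    trans (*-cong (x≈y^p Fin.zero) (prodPow-^ p r _ _ _ (λ i → x≈y^p (Fin.suc i))))
          (sym (^-distrib-* _ _ p))

  prodPow-root : ∀ {p r} (a : Fin r → Unit K) x → (∀ i → + p ℤ∣.∣ x i) →
    ∃ λ y → (∀ i → ∣ x i ∣ ≡ p ℕ.* ∣ y i ∣) × prodPow K r a x ≈ prodPow K r a y ^ p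
  prodPow-root {p} {r} a x p∣x =
    y , (λ i → proj₁ (root i)) , prodPow-^ p r a x y (λ i → proj₂ (root i))
    where
      y : Fin r → ℤ
      y i = proj₁ (zpow-root (a i) (x i) (p∣x i))
      root : ∀ i → ∣ x i ∣ ≡ p ℕ.* ∣ y i ∣ × zpow K (a i) (x i) ≈ zpow K (a i) (y i) ^ p
      root i = proj₂ (zpow-root (a i) (x i) (p∣x i))

  ^-ratio-root : ∀ p .{{_ : NonZero p}} (t : Unit K) {w ζ} → w ^ p * ζ ≈ val t ^ p →
    ∃ λ η → val t ≈ w * η × η ^ p ≈ ζ
  ^-ratio-root (suc k) t {w} {ζ} wζ≈t = w⁻¹ * val t , t≈wη , η^p≈ζ
    where
      p = suc k
      -- w is invertible because w^p ζ is the unit t^p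
      w⁻¹ : Carrier
      w⁻¹ = w ^ k * ζ * inv t ^ p
      w*w⁻¹≈1 : w * w⁻¹ ≈ 1#
      w*w⁻¹≈1 = begin
        w * (w ^ k * ζ * inv t ^ p)  ≈⟨ *-assoc _ _ _ ⟨
        w * (w ^ k * ζ) * inv t ^ p  ≈⟨ *-congʳ (*-assoc _ _ _) ⟨
        w ^ p * ζ * inv t ^ p        ≈⟨ *-congʳ wζ≈t ⟩
        val t ^ p * inv t ^ p        ≈⟨ inverse (powUnit t p) ⟩
        1#                           ∎
      t≈wη : val t ≈ w * (w⁻¹ * val t)
      t≈wη = begin
        val t              ≈⟨ *-identityˡ _ ⟨
        1# * val t         ≈⟨ *-congʳ w*w⁻¹≈1 ⟨
        w * w⁻¹ * val t    ≈⟨ *-assoc _ _ _ ⟩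
        w * (w⁻¹ * val t)  ∎
      η^p≈ζ : (w⁻¹ * val t) ^ p ≈ ζ
      η^p≈ζ = begin
        (w⁻¹ * val t) ^ p        ≈⟨ ^-distrib-* _ _ p ⟩
        w⁻¹ ^ p * val t ^ p      ≈⟨ *-congˡ wζ≈t ⟨
        w⁻¹ ^ p * (w ^ p * ζ)    ≈⟨ *-assoc _ _ _ ⟨
        w⁻¹ ^ p * w ^ p * ζ      ≈⟨ *-congʳ (^-distrib-* _ _ p) ⟨
        (w⁻¹ * w) ^ p * ζ        ≈⟨ *-congʳ (^-congˡ p (trans (*-comm _ _) w*w⁻¹≈1)) ⟩
        1# ^ p * ζ               ≈⟨ *-congʳ (1^n≈1 p) ⟩
        1# * ζ                   ≈⟨ *-identityˡ ζ ⟩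
        ζ                        ∎

  RootOfUnityℓPower-root : ∀ {p η ζ} → η ^ p ≈ ζ → RootOfUnityℓPower K p ζ →
    RootOfUnityℓPower K p η
  RootOfUnityℓPower-root {p} {η} {ζ} η^p≈ζ (m , ζ^p^m≈1) = suc m , (begin
    η ^ (p ℕ.* p ℕ.^ m)  ≈⟨ ^-assocʳ η p (p ℕ.^ m) ⟨
    (η ^ p) ^ p ℕ.^ m    ≈⟨ ^-congˡ (p ℕ.^ m) η^p≈ζ ⟩
    ζ ^ p ℕ.^ m          ≈⟨ ζ^p^m≈1 ⟩
    1#                   ∎)

  prodPow-descent : ∀ p .{{_ : NonZero p}} {r} (a : Fin r → Unit K) x {ζ} (t : Unit K) →
    RootOfUnityℓPower K p ζ → val t ^ p ≈ prodPow K r a x * ζ → (∀ i → + p ℤ∣.∣ x i) →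
    ∃₂ λ y η → RootOfUnityℓPower K p η × val t ≈ prodPow K r a y * η ×
               (∀ i → ∣ x i ∣ ≡ p ℕ.* ∣ y i ∣)
  prodPow-descent p a x t ζ-root t^p≈xζ p∣x with prodPow-root a x p∣x
  ... | y , x≡p*y , x≈y^p with ^-ratio-root p t (trans (*-congʳ (sym x≈y^p)) (sym t^p≈xζ))
  ... | η , t≈yη , η^p≈ζ = y , η , RootOfUnityℓPower-root η^p≈ζ ζ-root , t≈yη , x≡p*y

  twisted-InPowers⇒∣ : ∀ p .{{_ : NonZero p}} {r} (a : Fin r → Unit K) →
    StronglyIndependent K p r a → ∀ n x {ζ} → RootOfUnityℓPower K p ζ →
    InPowers K (p ℕ.^ n) (prodPow K r a x * ζ) → ∀ i → + (p ℕ.^ n) ℤ∣.∣ x i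
  twisted-InPowers⇒∣ p a indep zero x _ _ i = ℕ∣.1∣ _
  twisted-InPowers⇒∣ p a indep (suc n) x {ζ} ζ-root (z , z^p^[1+n]≈xζ) =
    by-cases (all? (λ i → p ℕ∣.∣? ∣ x i ∣))
    where
      t : Unit K
      t = powUnit z (p ℕ.^ n)
      t^p≈xζ : val t ^ p ≈ prodPow K _ a x * ζ
      t^p≈xζ = trans (sym (^-* (val z) p (p ℕ.^ n))) z^p^[1+n]≈xζ
      by-cases : Dec (∀ i → + p ℤ∣.∣ x i) → ∀ i → + (p ℕ.^ suc n) ℤ∣.∣ x i
      by-cases (no ¬p∣x) = ⊥-elim (indep x ¬p∣x (ζ , ζ-root , t , t^p≈xζ))
      by-cases (yes p∣x) with prodPow-descent p a x t ζ-root t^p≈xζ p∣x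
      ... | y , η , η-root , t≈yη , x≡p*y = λ i →
        P.subst (p ℕ.^ suc n ℕ∣.∣_) (P.sym (x≡p*y i))
          (ℕ∣.*-monoʳ-∣ p (twisted-InPowers⇒∣ p a indep n y η-root (z , t≈yη) i))

lemma2p6 : ∀ {c l : Level} (K : NumberField c l) (p : ℕ) → Prime p →
    (¬ (2 ℕ∣.∣ p) ⊎ HasZeta4 K) →
    (r : ℕ) (a : Fin r → Unit K) → StronglyIndependent K p r a →
    (x : Fin r → ℤ) (n : ℕ) →
    InPowers K (p ℕ.^ n) (prodPow K r a x) →
    ∀ i → (+ (p ℕ.^ n)) ℤ∣.∣ x i
lemma2p6 K p p-prime _ r a indep x n (z , z^p^n≈x) =
  twisted-InPowers⇒∣ K p {{prime⇒nonZero p-prime}} a indep n x (0 , *-identityʳ 1#)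
    (z , trans z^p^n≈x (sym (*-identityʳ _)))
  where open CommutativeRing (NumberField.ring K)
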